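{- In the standing setup of the context, every large vertex belongs to $V_1\cap V_2$, and every large vertex is adjacent to some vertex in $\overline{V_1}$ and to some vertex in $\overline{V_2}$.
   Context: Loop-free multigraph: finite undirected graph without loops, multiple edges between distinct vertices allowed. The type of an edge joining $u,v$ is $\{u,v\}$; its multiplicity is the number of edges of that type; an edge/type is simple if its multiplicity is one and non-simple if at least two; a graph is simple if all edges are simple. Two vertices are adjacent if there is at least one edge between them. Double edge swap $(a_1,a_2)(a_3,a_4)$: remove two distinct edges of types $\{a_1,a_2\},\{a_3,a_4\}$ and add edges of types $\{a_2,a_3\},\{a_4,a_1\}$; admissible if the removed edges share no endpoint and not both are simple. Orders: fix finite $V$ and $d:V\to\mathbb{N}$, and a total order $<$ on $V$ with $d(u)<d(v)\Rightarrow u<v$. For $u_1>u_2$, $v_1>v_2$ set $\{u_1,u_2\}\le\{v_1,v_2\}$ iff $u_1<v_1$ or ($u_1=v_1$ and $u_2\le v_2$). For loop-free multigraphs on $V$ with degrees $d$: $G'<G$ iff $G$ is not simple and either the maximal non-simple type of $G$ is larger than all non-simple types of $G'$, or the maximal non-simple types of $G'$ and $G$ coincide and its multiplicity is strictly larger in $G$ than in $G'$. Standing setup: $G$ is a non-simple loop-free multigraph on $V$ with $\deg_G v=d(v)$ for all $v$, such that no finite sequence of admissible double edge swaps transforms $G$ into a graph $G'$ with $G'<G$. Let $\{u_1,u_2\}$, $u_1>u_2$, be the maximal non-simple type of $G$. Vertices other than $u_1,u_2$ are ordinary. For $i=1,2$, $V_i$ is the set of ordinary vertices adjacent to $u_i$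 and $\overline{V_i}$ the set of ordinary vertices not adjacent to $u_i$. An ordinary vertex is small if it is smaller than $u_1$ and large if it is larger than $u_1$. -}

module Defs where

open import Data.Nat as ℕ using (ℕ; zero; suc; _+_)
open import Data.Fin as Fin using (Fin; _≟_)
open import Data.Fin.Properties using ()
open import Data.List using (List; map; allFin)
open import Data.Nat.ListAction using (sum)
open import Data.Product using (Σ; _×_; _,_; ∃)
open import Data.Sum using (_⊎_)
open import Relation.Nullary using (¬_; Dec; yes; no)
open import Relation.Nullary.Decidable using (_×-dec_; _⊎-dec_)
open import Relation.Binary.PropositionalEquality using (_≡_; _≢_)

-- A loop-free multigraph on the vertex set Fin n is given by its
-- multiplicity function: G u v = number of edges of type {u,v}.
Graph : ℕ → Set
Graph n = Fin n → Fin n → ℕ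

deg : ∀ {n} → Graph n → Fin n → ℕ
deg {n} G v = sum (map (G v) (allFin n))

IsGraphWithDegrees : ∀ {n} → (Fin n → ℕ) → Graph n → Set
IsGraphWithDegrees {n} d G =
  (∀ u v → G u v ≡ G v u) × (∀ v → G v v ≡ 0) × (∀ v → deg G v ≡ d v)

ind : ∀ {P : Set} → Dec P → ℕ
ind (yes _) = 1
ind (no _)  = 0

[_,_~_,_] : ∀ {n} → Fin n → Fin n → Fin n → Fin n → ℕ
[ x , y ~ a , b ] = ind (((x ≟ a) ×-dec (y ≟ b)) ⊎-dec ((x ≟ b) ×-dec (y ≟ a)))

-- G' arises from G by the admissible double edge swap (a1,a2)(a3,a4):
-- remove an edge of type {a1,a2} and one of type {a3,a4}, add edges of
-- types {a2,a3} and {a4,a1}.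
AdmissibleSwap : ∀ {n} → Graph n → Graph n → Set
AdmissibleSwap {n} G G' =
  Σ (Fin n) λ a1 → Σ (Fin n) λ a2 → Σ (Fin n) λ a3 → Σ (Fin n) λ a4 →
    (a1 ≢ a2) × (a1 ≢ a3) × (a1 ≢ a4) × (a2 ≢ a3) × (a2 ≢ a4) × (a3 ≢ a4)
    × (1 ℕ.≤ G a1 a2) × (1 ℕ.≤ G a3 a4)
    × ((2 ℕ.≤ G a1 a2) ⊎ (2 ℕ.≤ G a3 a4))
    × (∀ x y → G' x y + [ x , y ~ a1 , a2 ] + [ x , y ~ a3 , a4 ]
               ≡ G x y + [ x , y ~ a2 , a3 ] + [ x , y ~ a4 , a1 ])

-- order on types {v1,v2} (v1 > v2) : (v1,v2) ≤ (u1,u2)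
_⊑_ : ∀ {n} → Fin n × Fin n → Fin n × Fin n → Set
(v1 , v2) ⊑ (u1 , u2) = (v1 Fin.< u1) ⊎ ((v1 ≡ u1) × (v2 Fin.≤ u2))

_⊏_ : ∀ {n} → Fin n × Fin n → Fin n × Fin n → Set
(v1 , v2) ⊏ (u1 , u2) = (v1 Fin.< u1) ⊎ ((v1 ≡ u1) × (v2 Fin.< u2))

IsMaxNonSimple : ∀ {n} → Graph n → Fin n → Fin n → Set
IsMaxNonSimple G u1 u2 =
  (u2 Fin.< u1) × (2 ℕ.≤ G u1 u2)
  × (∀ v1 v2 → v2 Fin.< v1 → 2 ℕ.≤ G v1 v2 → (v1 , v2) ⊑ (u1 , u2))

_≺_ : ∀ {n} → Graph n → Graph n → Set
_≺_ {n} G' G =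
  Σ (Fin n) λ u1 → Σ (Fin n) λ u2 → IsMaxNonSimple G u1 u2 ×
    ( (∀ v1 v2 → v2 Fin.< v1 → 2 ℕ.≤ G' v1 v2 → (v1 , v2) ⊏ (u1 , u2))
    ⊎ (IsMaxNonSimple G' u1 u2 × (G' u1 u2 ℕ.< G u1 u2)) )

-- Every edge at a large vertex w is simple: a multiple edge at w would be a
-- non-simple type above {u₁ , u₂}.  Since deg uᵢ ≤ deg w while uᵢ has at least
-- two edges to its partner, comparing G w with G uᵢ after transposing uᵢ and w
-- shows that w has an ordinary neighbour x not adjacent to uᵢ.  If w were not
-- adjacent to the partner of uᵢ, the admissible swap removing one edge of type
-- {u₁ , u₂} and the edge {w , x} would only add edges of previously empty types,
-- so it would lower the multiplicity of {u₁ , u₂} without creating a new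
-- non-simple type, producing a smaller graph.
module Submission where

open import Defs
open import Data.Nat as ℕ using (ℕ; zero; suc; _+_; _∸_; _≤_; _<_; z≤n; s≤s; z<s)
open import Data.Nat.Properties hiding (_≟_)
open import Data.Nat.ListAction using (sum)
open import Data.Fin as Fin using (Fin; _≟_)
import Data.Fin.Properties as Finₚ
import Data.Fin.Permutation as Perm
open import Data.Fin.Permutation.Components using (transpose)
open import Data.List using (tabulate)
open import Data.List.Properties using (map-tabulate)
open import Algebra.Properties.CommutativeMonoid.Sum +-0-commutativeMonoid
  using (∑-permute; sum-syntax)
open import Data.Product using (Σ; _×_; _,_)
open import Data.Sum using (_⊎_; inj₁; inj₂)
open import Function using (_∘_)
open import Relation.Nullary using (¬_; Dec; yes; no; contradiction)
open import Relation.Nullary.Decidable using (dec-true; dec-false; _×-dec_; _⊎-dec_; ¬?)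
open import Relation.Binary.PropositionalEquality
open import Relation.Binary using (tri<; tri≈; tri>)
open import Relation.Binary.Construct.Closure.ReflexiveTransitive using (Star; ε; _◅_)

sum-tabulate : ∀ {n} (f : Fin n → ℕ) → sum (tabulate f) ≡ ∑[ i < n ] f i
sum-tabulate {zero}  f = refl
sum-tabulate {suc n} f = cong (f Fin.zero +_) (sum-tabulate (f ∘ Fin.suc))

deg≡∑ : ∀ {n} (G : Graph n) v → deg G v ≡ ∑[ x < n ] G v x
deg≡∑ G v = trans (cong sum (map-tabulate (λ x → x) (G v))) (sum-tabulate (G v))

∑-mono-≤ : ∀ {n} {f g : Fin n → ℕ} → (∀ i → f i ≤ g i) → ∑[ i < n ] f i ≤ ∑[ i < n ] g i
∑-mono-≤ {zero}  f≤g = z≤n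
∑-mono-≤ {suc n} f≤g = +-mono-≤ (f≤g Fin.zero) (∑-mono-≤ (f≤g ∘ Fin.suc))

∑-mono-< : ∀ {n} {f g : Fin n → ℕ} → (∀ i → f i ≤ g i) → ∀ j → f j < g j →
           ∑[ i < n ] f i < ∑[ i < n ] g i
∑-mono-< f≤g Fin.zero    fj<gj = +-mono-<-≤ fj<gj (∑-mono-≤ (f≤g ∘ Fin.suc))
∑-mono-< f≤g (Fin.suc j) fj<gj = +-mono-≤-< (f≤g Fin.zero) (∑-mono-< (f≤g ∘ Fin.suc) j fj<gj)

transpose-matchˡ : ∀ {n} (i j : Fin n) → transpose i j i ≡ j
transpose-matchˡ i j rewrite dec-true (i ≟ i) refl = refl

transpose-matchʳ : ∀ {n} (i j : Fin n) → transpose i j j ≡ i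
transpose-matchʳ i j with j ≟ i
... | yes refl = refl
... | no j≢i rewrite dec-true (j ≟ j) refl = refl

transpose-fixed : ∀ {n} {i j k : Fin n} → k ≢ i → k ≢ j → transpose i j k ≡ k
transpose-fixed {i = i} {j} {k} k≢i k≢j rewrite dec-false (k ≟ i) k≢i | dec-false (k ≟ j) k≢j = refl

∑-transpose : ∀ {n} (f : Fin n → ℕ) (i j : Fin n) → ∑[ x < n ] f x ≡ ∑[ x < n ] f (transpose i j x)
∑-transpose f i j = ∑-permute f (Perm.transpose i j)

-- [ x , y ~ a , b ] unfolds to ind (sameType? x y a b).
SameType : ∀ {n} → Fin n → Fin n → Fin n → Fin n → Set
SameType x y a b = (x ≡ a × y ≡ b) ⊎ (x ≡ b × y ≡ a)

sameType? : ∀ {n} (x y a b : Fin n) → Dec (SameType x y a b)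
sameType? x y a b = ((x ≟ a) ×-dec (y ≟ b)) ⊎-dec ((x ≟ b) ×-dec (y ≟ a))

sameType⇒[~]≡1 : ∀ {n} {x y a b : Fin n} → SameType x y a b → [ x , y ~ a , b ] ≡ 1
sameType⇒[~]≡1 {x = x} {y} {a} {b} s with sameType? x y a b
... | yes _ = refl
... | no ¬s = contradiction s ¬s

¬sameType⇒[~]≡0 : ∀ {n} {x y a b : Fin n} → ¬ SameType x y a b → [ x , y ~ a , b ] ≡ 0
¬sameType⇒[~]≡0 {x = x} {y} {a} {b} ¬s with sameType? x y a b
... | yes s = contradiction s ¬s
... | no _  = refl

sameType-sym : ∀ {n} {x y a b : Fin n} → SameType x y a b → SameType x y b a
sameType-sym (inj₁ (x≡a , y≡b)) = inj₂ (x≡a , y≡b)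
sameType-sym (inj₂ (x≡b , y≡a)) = inj₁ (x≡b , y≡a)

sameType-≢ : ∀ {n} {x y a b : Fin n} → SameType x y a b → x ≢ y → a ≢ b
sameType-≢ (inj₁ (refl , refl)) x≢y = x≢y
sameType-≢ (inj₂ (refl , refl)) x≢y = x≢y ∘ sym

sameType-fresh : ∀ {n} {x y a b c d : Fin n} → SameType x y a b → c ≢ a → c ≢ b → ¬ SameType x y c d
sameType-fresh (inj₁ (refl , refl)) c≢a c≢b (inj₁ (refl , refl)) = c≢a refl
sameType-fresh (inj₁ (refl , refl)) c≢a c≢b (inj₂ (refl , refl)) = c≢b refl
sameType-fresh (inj₂ (refl , refl)) c≢a c≢b (inj₁ (refl , refl)) = c≢b refl
sameType-fresh (inj₂ (refl , refl)) c≢a c≢b (inj₂ (refl , refl)) = c≢a refl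

⊑∧≢⇒⊏ : ∀ {n} {v w : Fin n × Fin n} → v ⊑ w → v ≢ w → v ⊏ w
⊑∧≢⇒⊏ (inj₁ v₁<w₁)          v≢w = inj₁ v₁<w₁
⊑∧≢⇒⊏ (inj₂ (refl , v₂≤w₂)) v≢w = inj₂ (refl , Finₚ.≤∧≢⇒< v₂≤w₂ (λ { refl → v≢w refl }))

⊑⇒≤ : ∀ {n} {v₁ v₂ u₁ u₂ : Fin n} → (v₁ , v₂) ⊑ (u₁ , u₂) → v₁ Fin.≤ u₁
⊑⇒≤ (inj₁ v₁<u₁)     = <⇒≤ v₁<u₁
⊑⇒≤ (inj₂ (refl , _)) = ≤-refl

≺-by-lowering-max : ∀ {n} {G G′ : Graph n} {u₁ u₂ : Fin n} → IsMaxNonSimple G u₁ u₂ →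
                    G′ u₁ u₂ < G u₁ u₂ → (∀ x y → 2 ≤ G′ x y → 2 ≤ G x y) → G′ ≺ G
≺-by-lowering-max {G′ = G′} {u₁} {u₂} max@(u₂<u₁ , _ , below) lowered no-new with 2 ≤? G′ u₁ u₂
... | yes multi = u₁ , u₂ , max ,
  inj₂ ((u₂<u₁ , multi , λ v₁ v₂ v₂<v₁ → below v₁ v₂ v₂<v₁ ∘ no-new v₁ v₂) , lowered)
... | no simple  = u₁ , u₂ , max , inj₁ λ v₁ v₂ v₂<v₁ multi →
  ⊑∧≢⇒⊏ (below v₁ v₂ v₂<v₁ (no-new v₁ v₂ multi)) λ { refl → simple multi }

AllDistinct : ∀ {n} → Fin n → Fin n → Fin n → Fin n → Set
AllDistinct a₁ a₂ a₃ a₄ = (a₁ ≢ a₂) × (a₁ ≢ a₃) × (a₁ ≢ a₄) × (a₂ ≢ a₃) × (a₂ ≢ a₄) × (a₃ ≢ a₄)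

-- The truncated subtraction is exact when both removed edges exist (see balance).
swap : ∀ {n} → Graph n → (a₁ a₂ a₃ a₄ : Fin n) → Graph n
swap G a₁ a₂ a₃ a₄ x y =
  (G x y + [ x , y ~ a₂ , a₃ ] + [ x , y ~ a₄ , a₁ ]) ∸ ([ x , y ~ a₁ , a₂ ] + [ x , y ~ a₃ , a₄ ])

module SymmetricGraph {n} {G : Graph n} (G-sym : ∀ u v → G u v ≡ G v u) where

  sameType⇒≡ : ∀ {x y a b} → SameType x y a b → G x y ≡ G a b
  sameType⇒≡ (inj₁ (refl , refl)) = refl
  sameType⇒≡ (inj₂ (refl , refl)) = G-sym _ _

  swap-admissible : ∀ {a₁ a₂ a₃ a₄} → AllDistinct a₁ a₂ a₃ a₄ →
                    1 ≤ G a₁ a₂ → 1 ≤ G a₃ a₄ → 2 ≤ G a₁ a₂ ⊎ 2 ≤ G a₃ a₄ →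
                    AdmissibleSwap G (swap G a₁ a₂ a₃ a₄)
  swap-admissible {a₁} {a₂} {a₃} {a₄} (a₁≢a₂ , a₁≢a₃ , a₁≢a₄ , a₂≢a₃ , a₂≢a₄ , a₃≢a₄) e₁₂ e₃₄ multi =
    a₁ , a₂ , a₃ , a₄ , a₁≢a₂ , a₁≢a₃ , a₁≢a₄ , a₂≢a₃ , a₂≢a₄ , a₃≢a₄ , e₁₂ , e₃₄ , multi , balance
    where
    removed≤ : ∀ x y → [ x , y ~ a₁ , a₂ ] + [ x , y ~ a₃ , a₄ ] ≤ G x y
    removed≤ x y with sameType? x y a₁ a₂ | sameType? x y a₃ a₄
    ... | yes s₁₂ | yes s₃₄ = contradiction s₃₄ (sameType-fresh s₁₂ (≢-sym a₁≢a₃) (≢-sym a₂≢a₃))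
    ... | yes s₁₂ | no _    = ≤-trans e₁₂ (≤-reflexive (sym (sameType⇒≡ s₁₂)))
    ... | no _    | yes s₃₄ = ≤-trans e₃₄ (≤-reflexive (sym (sameType⇒≡ s₃₄)))
    ... | no _    | no _    = z≤n

    balance : ∀ x y → swap G a₁ a₂ a₃ a₄ x y + [ x , y ~ a₁ , a₂ ] + [ x , y ~ a₃ , a₄ ]
                      ≡ G x y + [ x , y ~ a₂ , a₃ ] + [ x , y ~ a₄ , a₁ ]
    balance x y = trans (+-assoc (swap G a₁ a₂ a₃ a₄ x y) _ _)
      (m∸n+n≡m (≤-trans (removed≤ x y) (≤-trans (m≤m+n _ _) (m≤m+n _ _))))

  swap-lowers : ∀ {a₁ a₂ a₃ a₄ x y} → AllDistinct a₁ a₂ a₃ a₄ → SameType x y a₁ a₂ → 1 ≤ G x y →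
                swap G a₁ a₂ a₃ a₄ x y < G x y
  swap-lowers {a₁} {a₂} {a₃} {a₄} {x} {y} (_ , a₁≢a₃ , a₁≢a₄ , a₂≢a₃ , a₂≢a₄ , _) s₁₂ e = begin-strict
    swap G a₁ a₂ a₃ a₄ x y
      ≡⟨ cong₂ _∸_ (cong₂ (λ p q → G x y + p + q) (¬sameType⇒[~]≡0 ¬s₂₃) (¬sameType⇒[~]≡0 ¬s₄₁))
                   (cong₂ _+_ (sameType⇒[~]≡1 s₁₂) (¬sameType⇒[~]≡0 ¬s₃₄)) ⟩
    (G x y + 0 + 0) ∸ 1
      ≡⟨ cong (_∸ 1) (trans (+-identityʳ (G x y + 0)) (+-identityʳ (G x y))) ⟩
    G x y ∸ 1
      <⟨ ∸-monoʳ-< z<s e ⟩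
    G x y ∎
    where
    open ≤-Reasoning
    ¬s₂₃ : ¬ SameType x y a₂ a₃
    ¬s₂₃ = sameType-fresh s₁₂ (≢-sym a₁≢a₃) (≢-sym a₂≢a₃) ∘ sameType-sym
    ¬s₄₁ : ¬ SameType x y a₄ a₁
    ¬s₄₁ = sameType-fresh s₁₂ (≢-sym a₁≢a₄) (≢-sym a₂≢a₄)
    ¬s₃₄ : ¬ SameType x y a₃ a₄
    ¬s₃₄ = sameType-fresh s₁₂ (≢-sym a₁≢a₃) (≢-sym a₂≢a₃)

  swap-multiple⇒multiple : ∀ {a₁ a₂ a₃ a₄} → AllDistinct a₁ a₂ a₃ a₄ → G a₂ a₃ ≡ 0 → G a₄ a₁ ≡ 0 →
                           ∀ x y → 2 ≤ swap G a₁ a₂ a₃ a₄ x y → 2 ≤ G x y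
  swap-multiple⇒multiple {a₁} {a₂} {a₃} {a₄} (_ , _ , _ , _ , a₂≢a₄ , a₃≢a₄) g₂₃ g₄₁ x y multi =
    by-added-types (sameType? x y a₂ a₃) (sameType? x y a₄ a₁)
    where
    open ≤-Reasoning
    2≤G+added : 2 ≤ G x y + [ x , y ~ a₂ , a₃ ] + [ x , y ~ a₄ , a₁ ]
    2≤G+added = ≤-trans multi (m∸n≤m _ ([ x , y ~ a₁ , a₂ ] + [ x , y ~ a₃ , a₄ ]))

    by-added-types : Dec (SameType x y a₂ a₃) → Dec (SameType x y a₄ a₁) → 2 ≤ G x y
    by-added-types (yes s₂₃) _ = contradiction (begin
      2                                                 ≤⟨ 2≤G+added ⟩
      G x y + [ x , y ~ a₂ , a₃ ] + [ x , y ~ a₄ , a₁ ]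
        ≡⟨ cong₂ _+_ (cong₂ _+_ (trans (sameType⇒≡ s₂₃) g₂₃) (sameType⇒[~]≡1 s₂₃))
                     (¬sameType⇒[~]≡0 (sameType-fresh s₂₃ (≢-sym a₂≢a₄) (≢-sym a₃≢a₄))) ⟩
      1                                                 ∎) λ { (s≤s ()) }
    by-added-types (no ¬s₂₃) (yes s₄₁) = contradiction (begin
      2                                                 ≤⟨ 2≤G+added ⟩
      G x y + [ x , y ~ a₂ , a₃ ] + [ x , y ~ a₄ , a₁ ]
        ≡⟨ cong₂ _+_ (cong₂ _+_ (trans (sameType⇒≡ s₄₁) g₄₁) (¬sameType⇒[~]≡0 ¬s₂₃))
                     (sameType⇒[~]≡1 s₄₁) ⟩
      1                                                 ∎) λ { (s≤s ()) }
    by-added-types (no ¬s₂₃) (no ¬s₄₁) = begin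
      2                                                 ≤⟨ 2≤G+added ⟩
      G x y + [ x , y ~ a₂ , a₃ ] + [ x , y ~ a₄ , a₁ ]
        ≡⟨ cong₂ _+_ (cong (G x y +_) (¬sameType⇒[~]≡0 ¬s₂₃)) (¬sameType⇒[~]≡0 ¬s₄₁) ⟩
      G x y + 0 + 0                                     ≡⟨ trans (+-identityʳ _) (+-identityʳ _) ⟩
      G x y                                             ∎

  swap-≺ : ∀ {a₁ a₂ a₃ a₄ u₁ u₂} → AllDistinct a₁ a₂ a₃ a₄ → IsMaxNonSimple G u₁ u₂ → SameType u₁ u₂ a₁ a₂ →
           G a₂ a₃ ≡ 0 → G a₄ a₁ ≡ 0 → swap G a₁ a₂ a₃ a₄ ≺ G
  swap-≺ distinct max@(_ , multi , _) s g₂₃ g₄₁ =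
    ≺-by-lowering-max max (swap-lowers distinct s (≤-trans (s≤s z≤n) multi))
                          (swap-multiple⇒multiple distinct g₂₃ g₄₁)

  no-smaller-swap⇒adjacent : ∀ {u₁ u₂ a b w y} → (∀ G′ → Star AdmissibleSwap G G′ → ¬ (G′ ≺ G)) →
                             IsMaxNonSimple G u₁ u₂ → SameType u₁ u₂ a b →
                             w ≢ a → w ≢ b → y ≢ a → y ≢ b → w ≢ y →
                             G y a ≡ 0 → 1 ≤ G w y → 1 ≤ G w b
  no-smaller-swap⇒adjacent {a = a} {b} {w} {y} minimal max@(u₂<u₁ , multi , _) s w≢a w≢b y≢a y≢b w≢y g-ya e-wy
    with 1 ≤? G w b
  ... | yes e-wb = e-wb
  ... | no ¬e-wb = contradiction (swap-≺ distinct max s (trans (G-sym b w) (n<1⇒n≡0 (≰⇒> ¬e-wb))) g-ya)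
                                 (minimal _ (swap-admissible distinct e-ab e-wy (inj₁ multi-ab) ◅ ε))
    where
    distinct : AllDistinct a b w y
    distinct = sameType-≢ s (Finₚ.<⇒≢ u₂<u₁ ∘ sym) , ≢-sym w≢a , ≢-sym y≢a , ≢-sym w≢b , ≢-sym y≢b , w≢y
    multi-ab : 2 ≤ G a b
    multi-ab = subst (2 ≤_) (sameType⇒≡ s) multi
    e-ab : 1 ≤ G a b
    e-ab = ≤-trans (s≤s z≤n) multi-ab

  module Loopless (G-loopless : ∀ v → G v v ≡ 0) where

    adjacent⇒≢ : ∀ {u v} → 1 ≤ G u v → u ≢ v
    adjacent⇒≢ {u} e refl = contradiction (subst (1 ≤_) (G-loopless u) e) λ ()

    large-vertex-simple : ∀ {u₁ u₂ w} → IsMaxNonSimple G u₁ u₂ → u₁ Fin.< w → ∀ y → G w y ≤ 1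
    large-vertex-simple {u₁} {u₂} {w} (_ , _ , below) u₁<w y = ≮⇒≥ not-multiple
      where
      not-multiple : ¬ (2 ≤ G w y)
      not-multiple multi with Finₚ.<-cmp y w
      ... | tri< y<w _ _ = <⇒≱ u₁<w (⊑⇒≤ (below w y y<w multi))
      ... | tri≈ _ refl _ = contradiction (subst (2 ≤_) (G-loopless w) multi) λ ()
      ... | tri> _ _ w<y = <⇒≱ (Finₚ.<-trans u₁<w w<y) (⊑⇒≤ (below y w w<y (subst (2 ≤_) (G-sym w y) multi)))

    deg-<-if-dominated : ∀ {u w z} → u ≢ w → (∀ x → x ≢ u → x ≢ w → G w x ≤ G u x) →
                         z ≢ u → z ≢ w → G w z < G u z → deg G w < deg G u
    deg-<-if-dominated {u} {w} {z} u≢w dominated z≢u z≢w wz<uz = begin-strict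
      deg G w                          ≡⟨ deg≡∑ G w ⟩
      ∑[ x < n ] G w x                 ≡⟨ ∑-transpose (G w) u w ⟩
      ∑[ x < n ] G w (transpose u w x) <⟨ ∑-mono-< dominated′ z wτz<uz ⟩
      ∑[ x < n ] G u x                 ≡⟨ deg≡∑ G u ⟨
      deg G u                          ∎
      where
      open ≤-Reasoning
      G-w∘τ-fixed : ∀ {x} → x ≢ u → x ≢ w → G w (transpose u w x) ≡ G w x
      G-w∘τ-fixed x≢u x≢w = cong (G w) (transpose-fixed x≢u x≢w)

      wτz<uz : G w (transpose u w z) < G u z
      wτz<uz = subst (_< G u z) (sym (G-w∘τ-fixed z≢u z≢w)) wz<uz

      dominated′ : ∀ x → G w (transpose u w x) ≤ G u x
      dominated′ x = by-position (x ≟ u) (x ≟ w)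
        where
        by-position : Dec (x ≡ u) → Dec (x ≡ w) → G w (transpose u w x) ≤ G u x
        by-position (yes refl) _ =
          ≤-trans (≤-reflexive (trans (cong (G w) (transpose-matchˡ u w)) (G-loopless w))) z≤n
        by-position (no _) (yes refl) =
          ≤-reflexive (trans (cong (G w) (transpose-matchʳ u w)) (G-sym w u))
        by-position (no x≢u) (no x≢w) =
          subst (_≤ G u x) (sym (G-w∘τ-fixed x≢u x≢w)) (dominated x x≢u x≢w)

    non-neighbour-exists : ∀ {u z w} → u ≢ z → u ≢ w → z ≢ w → 2 ≤ G u z → (∀ y → G w y ≤ 1) →
                           deg G u ≤ deg G w →
                           Σ (Fin n) λ x → (x ≢ u) × (x ≢ z) × (G x u ≡ 0) × (1 ≤ G w x)
    non-neighbour-exists {u} {z} {w} u≢z u≢w z≢w multi w-simple deg-u≤deg-w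
      with Finₚ.any? (λ x → ¬? (x ≟ u) ×-dec ¬? (x ≟ z) ×-dec (G x u ℕ.≟ 0) ×-dec (1 ≤? G w x))
    ... | yes found = found
    ... | no ¬found = contradiction deg-u≤deg-w
        (<⇒≱ (deg-<-if-dominated u≢w dominated (≢-sym u≢z) z≢w (≤-trans (s≤s (w-simple z)) multi)))
      where
      dominated : ∀ x → x ≢ u → x ≢ w → G w x ≤ G u x
      dominated x x≢u x≢w with x ≟ z | 1 ≤? G w x | G x u ℕ.≟ 0
      ... | yes refl | _ | _ = ≤-trans (w-simple x) (≤-trans (s≤s z≤n) multi)
      ... | no _ | no ¬e | _ = ≤-trans (≤-pred (≰⇒> ¬e)) z≤n
      ... | no x≢z | yes e | yes g = contradiction (x , x≢u , x≢z , g , e) ¬found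
      ... | no _ | yes _ | no g = ≤-trans (w-simple x) (subst (1 ≤_) (G-sym x u) (n≢0⇒n>0 g))

lemma5p4 : (n : ℕ) (d : Fin n → ℕ)
    → (∀ u v → d u ℕ.< d v → u Fin.< v)
    → (G : Graph n) → IsGraphWithDegrees d G
    → (∀ G' → Star AdmissibleSwap G G' → ¬ (G' ≺ G))
    → (u1 u2 : Fin n) → IsMaxNonSimple G u1 u2
    → (w : Fin n) → u1 Fin.< w
    → (1 ℕ.≤ G w u1) × (1 ℕ.≤ G w u2)
      × (Σ (Fin n) λ x → (x ≢ u1) × (x ≢ u2) × (G x u1 ≡ 0) × (1 ℕ.≤ G w x))
      × (Σ (Fin n) λ y → (y ≢ u1) × (y ≢ u2) × (G y u2 ≡ 0) × (1 ℕ.≤ G w y))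
lemma5p4 n d d-ordered G (G-sym , G-loopless , G-deg) minimal u₁ u₂ max@(u₂<u₁ , multi , _) w u₁<w =
  let (x , x≢u₁ , x≢u₂ , G-xu₁ , G-wx) =
        non-neighbour-exists u₁≢u₂ u₁≢w u₂≢w multi w-simple (deg-≤ u₁<w)
      (y , y≢u₂ , y≢u₁ , G-yu₂ , G-wy) =
        non-neighbour-exists (≢-sym u₁≢u₂) u₂≢w u₁≢w (subst (2 ≤_) (G-sym u₁ u₂) multi) w-simple (deg-≤ u₂<w)
  in no-smaller-swap⇒adjacent minimal max (inj₂ (refl , refl))
       (≢-sym u₂≢w) (≢-sym u₁≢w) y≢u₂ y≢u₁ (adjacent⇒≢ G-wy) G-yu₂ G-wy
   , no-smaller-swap⇒adjacent minimal max (inj₁ (refl , refl))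
       (≢-sym u₁≢w) (≢-sym u₂≢w) x≢u₁ x≢u₂ (adjacent⇒≢ G-wx) G-xu₁ G-wx
   , (x , x≢u₁ , x≢u₂ , G-xu₁ , G-wx)
   , (y , y≢u₁ , y≢u₂ , G-yu₂ , G-wy)
  where
  open SymmetricGraph G-sym
  open Loopless G-loopless

  u₁≢u₂ : u₁ ≢ u₂
  u₁≢u₂ = ≢-sym (Finₚ.<⇒≢ u₂<u₁)
  u₁≢w : u₁ ≢ w
  u₁≢w = Finₚ.<⇒≢ u₁<w
  u₂<w : u₂ Fin.< w
  u₂<w = Finₚ.<-trans u₂<u₁ u₁<w
  u₂≢w : u₂ ≢ w
  u₂≢w = Finₚ.<⇒≢ u₂<w

  w-simple : ∀ v → G w v ≤ 1
  w-simple = large-vertex-simple max u₁<w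

  deg-≤ : ∀ {v} → v Fin.< w → deg G v ≤ deg G w
  deg-≤ {v} v<w = subst₂ _≤_ (sym (G-deg v)) (sym (G-deg w))
    (≮⇒≥ λ dw<dv → Finₚ.<-asym v<w (d-ordered w v dw<dv))
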